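{- Let $n>2$ be an integer and let $S_n^0$ be the crown graph on $2n$ vertices. Let $\mathbf{F}$ be a field. Then \[ wcdim(S_n^0,\mathbf F)=\begin{cases} n & \text{if } char(\mathbf F)=p\neq 0 \text{ and } p \mid (n-2),\\ n-1 & \text{otherwise.}\end{cases} \]
   Context: All graphs are finite, simple and undirected. An independent set of a graph $G$ is a set of pairwise non-adjacent vertices; it is maximal if it is not properly contained in another independent set. For a field $\mathbf F$, a well-covered weighting of $G$ is a function $w:V(G)\to\mathbf F$ such that $\sum_{x\in M}w(x)$ takes the same value for every maximal independent set $M$ of $G$. The well-covered weightings form an $\mathbf F$-vector space, whose dimension is denoted $wcdim(G,\mathbf F)$ (the well-covered dimension). The crown graph $S_n^0$ is obtained from the complete bipartite graph $K_{n,n}$ by removing a perfect matching. -}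

module Defs where

open import Level using (Level; _⊔_) renaming (suc to lsuc)
open import Algebra.Bundles using (CommutativeRing)
open import Data.Nat using (ℕ; zero; suc; _<_) renaming (_+_ to _+ℕ_)
open import Data.Fin using (Fin; splitAt)
import Data.Fin as Fin
open import Data.Bool using (Bool; true; false; if_then_else_)
open import Data.Vec using (Vec; lookup)
open import Data.Sum using (_⊎_; inj₁; inj₂)
open import Data.Product using (Σ; _×_; _,_)
open import Data.Empty using (⊥)
open import Data.Unit using (⊤)
open import Relation.Nullary using (¬_)
open import Relation.Binary.PropositionalEquality using (_≡_)

record Field (c ℓ : Level) : Set (lsuc (c ⊔ ℓ)) where
  field
    commutativeRing : CommutativeRing c ℓ
  open CommutativeRing commutativeRing public
  field
    0≉1     : ¬ (0# ≈ 1#)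
    inverse : ∀ x → ¬ (x ≈ 0#) → Σ Carrier λ y → x * y ≈ 1#

module _ {c ℓ : Level} (F : Field c ℓ) where
  open Field F

  ℕ→F : ℕ → Carrier
  ℕ→F zero    = 0#
  ℕ→F (suc k) = 1# + ℕ→F k

  HasChar : ℕ → Set ℓ
  HasChar zero    = ∀ k → ¬ (ℕ→F (suc k) ≈ 0#)
  HasChar (suc p) = (ℕ→F (suc p) ≈ 0#) × (∀ k → k < p → ¬ (ℕ→F (suc k) ≈ 0#))

record Graph (m : ℕ) : Set₁ where
  field
    Adj       : Fin m → Fin m → Set
    symmetric : ∀ {x y} → Adj x y → Adj y x
    irreflex  : ∀ {x} → ¬ Adj x x
open Graph public

-- Crown graph S_n^0 on Fin (n + n): vertex x ↦ splitAt n x ∈ Fin n ⊎ Fin n.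
-- It is K_{n,n} minus the perfect matching {inj₁ i, inj₂ i}.
crownAdj′ : {n : ℕ} → Fin n ⊎ Fin n → Fin n ⊎ Fin n → Set
crownAdj′ (inj₁ i) (inj₁ j) = ⊥
crownAdj′ (inj₁ i) (inj₂ j) = ¬ (i ≡ j)
crownAdj′ (inj₂ i) (inj₁ j) = ¬ (i ≡ j)
crownAdj′ (inj₂ i) (inj₂ j) = ⊥

crownSym : {n : ℕ} (a b : Fin n ⊎ Fin n) → crownAdj′ a b → crownAdj′ b a
crownSym (inj₁ i) (inj₂ j) h e = h (Relation.Binary.PropositionalEquality.sym e)
crownSym (inj₂ i) (inj₁ j) h e = h (Relation.Binary.PropositionalEquality.sym e)

crownIrr : {n : ℕ} (a : Fin n ⊎ Fin n) → ¬ crownAdj′ a a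
crownIrr (inj₁ i) ()
crownIrr (inj₂ i) ()

crown : (n : ℕ) → Graph (n +ℕ n)
crown n = record
  { Adj       = λ x y → crownAdj′ (splitAt n x) (splitAt n y)
  ; symmetric = λ {x} {y} → crownSym (splitAt n x) (splitAt n y)
  ; irreflex  = λ {x} → crownIrr (splitAt n x)
  }

module _ {m : ℕ} (G : Graph m) where

  _∈ₛ_ : Fin m → Vec Bool m → Set
  x ∈ₛ S = lookup S x ≡ true

  Independent : Vec Bool m → Set
  Independent S = ∀ x y → x ∈ₛ S → y ∈ₛ S → ¬ Adj G x y

  _⊆ₛ_ : Vec Bool m → Vec Bool m → Set
  S ⊆ₛ T = ∀ x → x ∈ₛ S → x ∈ₛ T

  MaximalIndependent : Vec Bool m → Set
  MaximalIndependent S =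
    Independent S × (∀ T → Independent T → S ⊆ₛ T → T ⊆ₛ S)

module _ {c ℓ : Level} (F : Field c ℓ) where
  open Field F

  ∑ : {m : ℕ} → (Fin m → Carrier) → Carrier
  ∑ {zero}  f = 0#
  ∑ {suc m} f = f Fin.zero + ∑ (λ i → f (Fin.suc i))

  weight : {m : ℕ} → (Fin m → Carrier) → Vec Bool m → Carrier
  weight w S = ∑ (λ x → if lookup S x then w x else 0#)

  WellCovered : {m : ℕ} → Graph m → (Fin m → Carrier) → Set ℓ
  WellCovered G w = ∀ M M′ → MaximalIndependent G M → MaximalIndependent G M′ →
                    weight w M ≈ weight w M′

  lincomb : {m d : ℕ} → (Fin d → Carrier) → (Fin d → Fin m → Carrier) → Fin m → Carrier
  lincomb coef v x = ∑ (λ i → coef i * v i x)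

  -- the well-covered weightings of G form a subspace of F^m; it has
  -- dimension d iff it has a basis of d vectors:
  -- d well-covered weightings, linearly independent, spanning all of them.
  WcDim : {m : ℕ} → Graph m → ℕ → Set (c ⊔ ℓ)
  WcDim {m} G d = Σ (Fin d → Fin m → Carrier) λ B →
      (∀ i → WellCovered G (B i))
    × (∀ coef → (∀ x → lincomb coef B x ≈ 0#) → ∀ i → coef i ≈ 0#)
    × (∀ w → WellCovered G w → Σ (Fin d → Carrier) λ coef → ∀ x → w x ≈ lincomb coef B x)

module Submission where

-- Write aᵢ, bᵢ (i < n) for the two sides of S⁰ₙ, aᵢ ~ bⱼ iff i ≠ j.
-- 1. Combinatorics: every independent set lies in A = {aᵢ}, in B = {bᵢ}
--    or in a non-edge Pᵢ = {aᵢ, bᵢ}; for n ≥ 2 all of these are maximal.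
-- 2. Hence w is well-covered iff it is "balanced": there is s with
--    w(aᵢ) + w(bᵢ) = s for all i, ΣA = s and ΣB = s.  Adding the pair
--    conditions gives ΣA + ΣB = n·s, so balance forces (n - 2)·s = 0,
--    and conversely the condition on B follows when (n - 2)·s = 0.
-- 3. A family that is the identity matrix at d chosen vertices and spans
--    the well-covered weightings is a basis (coordinate-basis).
-- 4. If n - 2 = 0 in F, the values on A are free coordinates (d = n);
--    otherwise s = 0, so bᵢ = -aᵢ and ΣA = 0, leaving d = n - 1 free
--    coordinates a₁, …, aₙ₋₁.  Which case occurs is decided by the fact
--    that k·1 = 0 in F exactly when char F divides k.

open import Defs
open import Level using (Level)
open import Data.Nat using (ℕ; zero; suc; _<_; _≤_; _∸_; s≤s; z≤n)
  renaming (_+_ to _+ℕ_; _*_ to _*ℕ_)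
open import Data.Nat.Divisibility using (_∣_; divides; _∣0; 0∣⇒≡0; m%n≡0⇒n∣m)
open import Data.Nat.DivMod using (_%_; _/_; m≡m%n+[m/n]*n; m%n<n)
open import Data.Fin using (Fin; splitAt; join; _≟_; _↑ˡ_; _↑ʳ_)
import Data.Fin as Fin
open import Data.Fin.Properties using (splitAt-join; join-splitAt; any?)
open import Data.Vec using (Vec; lookup; tabulate)
open import Data.Vec.Properties using (lookup∘tabulate)
open import Data.Bool using (Bool; true; false; if_then_else_)
import Data.Bool.Properties as Bool
open import Data.Sum using (_⊎_; inj₁; inj₂)
open import Data.Product using (∃; _×_; _,_; proj₁; proj₂)
open import Data.Empty using (⊥-elim)
open import Function using (_∘_)
open import Relation.Nullary using (¬_; yes; no; does)
open import Relation.Nullary.Decidable using (dec-true; decidable-stable)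
open import Relation.Binary.PropositionalEquality as ≡ using (_≡_; _≢_)

_==_ : {n : ℕ} → Fin n → Fin n → Bool
i == j = does (i ≟ j)

==-sound : {n : ℕ} (i j : Fin n) → (i == j) ≡ true → i ≡ j
==-sound i j eq with i ≟ j
... | yes i≡j = i≡j

==-complete : {n : ℕ} (i j : Fin n) → i ≡ j → (i == j) ≡ true
==-complete i j = dec-true (i ≟ j)

==-refl : {n : ℕ} (i : Fin n) → (i == i) ≡ true
==-refl i = ==-complete i i ≡.refl

==-false : {n : ℕ} (i j : Fin n) → (i == j) ≡ false → i ≢ j
==-false i _ eq ≡.refl with () ← ≡.trans (≡.sym (==-refl i)) eq

==-sym : {n : ℕ} (i j : Fin n) → (i == j) ≡ (j == i)
==-sym Fin.zero    Fin.zero    = ≡.refl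
==-sym Fin.zero    (Fin.suc j) = ≡.refl
==-sym (Fin.suc i) Fin.zero    = ≡.refl
==-sym (Fin.suc i) (Fin.suc j) = ==-sym i j

another : {n : ℕ} → 2 ≤ n → (j : Fin n) → ∃ λ i → i ≢ j
another (s≤s (s≤s _)) Fin.zero    = Fin.suc Fin.zero , λ ()
another (s≤s (s≤s _)) (Fin.suc j) = Fin.zero , λ ()

true-ext : {a b : Bool} → (a ≡ true → b ≡ true) → (b ≡ true → a ≡ true) → a ≡ b
true-ext {false} {false} _ _ = ≡.refl
true-ext {false} {true}  _ b⇒a = b⇒a ≡.refl
true-ext {true}  {false} a⇒b _ = ≡.sym (a⇒b ≡.refl)
true-ext {true}  {true}  _ _ = ≡.refl

_≐_ : {m : ℕ} → Vec Bool m → Vec Bool m → Set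
S ≐ T = ∀ x → lookup S x ≡ lookup T x

module _ {m : ℕ} (G : Graph m) where

  maximal-⊆⇒≐ : ∀ M T → MaximalIndependent G M → Independent G T →
                _⊆ₛ_ G M T → M ≐ T
  maximal-⊆⇒≐ M T (_ , maximal) indT M⊆T x =
    true-ext (M⊆T x) (maximal T indT M⊆T x)

  dominating⇒maximal : ∀ {S} → Independent G S →
    (∀ x → lookup S x ≡ false → ∃ λ y → _∈ₛ_ G y S × Adj G x y) →
    MaximalIndependent G S
  dominating⇒maximal {S} indS dominating = indS , extend
    where
    extend : ∀ T → Independent G T → _⊆ₛ_ G S T → _⊆ₛ_ G T S
    extend T indT S⊆T x x∈T with lookup S x in eq
    ... | true  = ≡.refl
    ... | false with dominating x eq
    ...   | y , y∈S , x~y = ⊥-elim (indT x y x∈T (S⊆T y y∈S) x~y)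

-- The crown graph S⁰ₙ, with vertices aᵢ = inj₁ i and bᵢ = inj₂ i of
-- Side n; aᵢ ~ bⱼ exactly when i ≠ j.
Side : ℕ → Set
Side n = Fin n ⊎ Fin n

module CrownSets (n : ℕ) where

  vertex : Side n → Fin (n +ℕ n)
  vertex = join n n

  ⟦_⟧ : (Side n → Bool) → Vec Bool (n +ℕ n)
  ⟦ g ⟧ = tabulate (g ∘ splitAt n)

  lookup-⟦⟧ : ∀ g x → lookup ⟦ g ⟧ x ≡ g (splitAt n x)
  lookup-⟦⟧ g = lookup∘tabulate (g ∘ splitAt n)

  lookup-⟦⟧-vertex : ∀ g u → lookup ⟦ g ⟧ (vertex u) ≡ g u
  lookup-⟦⟧-vertex g u = ≡.trans (lookup-⟦⟧ g (vertex u)) (≡.cong g (splitAt-join n n u))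

  _∈ᵥ_ : Side n → Vec Bool (n +ℕ n) → Set
  u ∈ᵥ S = _∈ₛ_ (crown n) (vertex u) S

  ∈ᵥ-splitAt : ∀ {S} x → _∈ₛ_ (crown n) x S → splitAt n x ∈ᵥ S
  ∈ᵥ-splitAt {S} x x∈S = ≡.trans (≡.cong (lookup S) (join-splitAt n n x)) x∈S

  adjacent : ∀ {u v} → crownAdj′ u v → Adj (crown n) (vertex u) (vertex v)
  adjacent {u} {v} = ≡.subst₂ crownAdj′ (≡.sym (splitAt-join n n u)) (≡.sym (splitAt-join n n v))

  nonadjacent : ∀ S {u v} → Independent (crown n) S → u ∈ᵥ S → v ∈ᵥ S → ¬ crownAdj′ u v
  nonadjacent S {u} {v} indS u∈S v∈S u~v = indS (vertex u) (vertex v) u∈S v∈S (adjacent u~v)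

  ⊆⟦⟧ : ∀ S g → (∀ u → u ∈ᵥ S → g u ≡ true) → _⊆ₛ_ (crown n) S ⟦ g ⟧
  ⊆⟦⟧ S g S⊆g x x∈S = ≡.trans (lookup-⟦⟧ g x) (S⊆g (splitAt n x) (∈ᵥ-splitAt {S} x x∈S))

  IndependentSides : (Side n → Bool) → Set
  IndependentSides g = ∀ u v → g u ≡ true → g v ≡ true → ¬ crownAdj′ u v

  DominatingSides : (Side n → Bool) → Set
  DominatingSides g = ∀ u → g u ≡ false → ∃ λ v → g v ≡ true × crownAdj′ u v

  ⟦⟧-independent : ∀ g → IndependentSides g → Independent (crown n) ⟦ g ⟧
  ⟦⟧-independent g indep x y x∈ y∈ =
    indep _ _ (≡.trans (≡.sym (lookup-⟦⟧ g x)) x∈) (≡.trans (≡.sym (lookup-⟦⟧ g y)) y∈)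

  ⟦⟧-maximal : ∀ g → IndependentSides g → DominatingSides g →
               MaximalIndependent (crown n) ⟦ g ⟧
  ⟦⟧-maximal g indep dom =
    dominating⇒maximal (crown n) {⟦ g ⟧} (⟦⟧-independent g indep) dominating
    where
    dominating : ∀ x → lookup ⟦ g ⟧ x ≡ false →
                 ∃ λ y → _∈ₛ_ (crown n) y ⟦ g ⟧ × Adj (crown n) x y
    dominating x x∉ with dom (splitAt n x) (≡.trans (≡.sym (lookup-⟦⟧ g x)) x∉)
    ... | v , gv , x~v =
      vertex v , ≡.trans (lookup-⟦⟧-vertex g v) gv ,
      ≡.subst₂ crownAdj′ ≡.refl (≡.sym (splitAt-join n n v)) x~v

  sideA sideB : Side n → Bool
  sideA (inj₁ _) = true
  sideA (inj₂ _) = false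
  sideB (inj₁ _) = false
  sideB (inj₂ _) = true

  pairP : Fin n → Side n → Bool
  pairP k (inj₁ j) = j == k
  pairP k (inj₂ j) = j == k

  sideA-independent : IndependentSides sideA
  sideA-independent (inj₁ _) (inj₁ _) _ _ ()

  sideB-independent : IndependentSides sideB
  sideB-independent (inj₂ _) (inj₂ _) _ _ ()

  pairP-independent : ∀ k → IndependentSides (pairP k)
  pairP-independent k (inj₁ i) (inj₂ j) ki kj i≢j =
    i≢j (≡.trans (==-sound i k ki) (≡.sym (==-sound j k kj)))
  pairP-independent k (inj₂ i) (inj₁ j) ki kj i≢j =
    i≢j (≡.trans (==-sound i k ki) (≡.sym (==-sound j k kj)))

  -- Each bⱼ has a neighbour aᵢ (i ≠ j) once n ≥ 2; symmetrically for A.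
  sideA-maximal : 2 ≤ n → MaximalIndependent (crown n) ⟦ sideA ⟧
  sideA-maximal 2≤n = ⟦⟧-maximal sideA sideA-independent dom
    where
    dom : DominatingSides sideA
    dom (inj₂ j) _ with another 2≤n j
    ... | i , i≢j = inj₁ i , ≡.refl , λ j≡i → i≢j (≡.sym j≡i)

  sideB-maximal : 2 ≤ n → MaximalIndependent (crown n) ⟦ sideB ⟧
  sideB-maximal 2≤n = ⟦⟧-maximal sideB sideB-independent dom
    where
    dom : DominatingSides sideB
    dom (inj₁ j) _ with another 2≤n j
    ... | i , i≢j = inj₂ i , ≡.refl , λ j≡i → i≢j (≡.sym j≡i)

  -- aⱼ (j ≠ k) is adjacent to bₖ, and bⱼ to aₖ.
  pairP-maximal : ∀ k → MaximalIndependent (crown n) ⟦ pairP k ⟧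
  pairP-maximal k = ⟦⟧-maximal (pairP k) (pairP-independent k) dom
    where
    dom : DominatingSides (pairP k)
    dom (inj₁ j) k≠j = inj₂ k , ==-refl k , ==-false j k k≠j
    dom (inj₂ j) k≠j = inj₁ k , ==-refl k , ==-false j k k≠j

  same-index : ∀ M {i j} → Independent (crown n) M →
               inj₁ i ∈ᵥ M → inj₂ j ∈ᵥ M → i ≡ j
  same-index M {i} {j} indM ai bj =
    decidable-stable (i ≟ j) (nonadjacent M {inj₁ i} {inj₂ j} indM ai bj)

  -- Every independent set lies inside A, inside B, or inside some Pₖ:
  -- if it meets both sides, in aᵢ and bⱼ say, then all its vertices are aᵢ, bᵢ.
  independent-classification : ∀ M → Independent (crown n) M →
    _⊆ₛ_ (crown n) M ⟦ sideA ⟧ ⊎ _⊆ₛ_ (crown n) M ⟦ sideB ⟧ ⊎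
    ∃ λ k → _⊆ₛ_ (crown n) M ⟦ pairP k ⟧
  independent-classification M indM
    with any? (λ j → lookup M (vertex (inj₂ j)) Bool.≟ true)
  ... | no noB = inj₁ (⊆⟦⟧ M sideA inA)
    where
    inA : ∀ u → u ∈ᵥ M → sideA u ≡ true
    inA (inj₁ _) _  = ≡.refl
    inA (inj₂ j) bj = ⊥-elim (noB (j , bj))
  ... | yes (j , bj) with any? (λ i → lookup M (vertex (inj₁ i)) Bool.≟ true)
  ...   | no noA = inj₂ (inj₁ (⊆⟦⟧ M sideB inB))
    where
    inB : ∀ u → u ∈ᵥ M → sideB u ≡ true
    inB (inj₁ i) ai = ⊥-elim (noA (i , ai))
    inB (inj₂ _) _  = ≡.refl
  ...   | yes (i , ai) = inj₂ (inj₂ (i , ⊆⟦⟧ M (pairP i) inP))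
    where
    inP : ∀ u → u ∈ᵥ M → pairP i u ≡ true
    inP (inj₁ k) ak =
      ==-complete k i (≡.trans (same-index M indM ak bj) (≡.sym (same-index M indM ai bj)))
    inP (inj₂ k) bk = ==-complete k i (≡.sym (same-index M indM ai bk))

  ⊆⟦⟧⇒≐ : ∀ M → MaximalIndependent (crown n) M → ∀ g → IndependentSides g →
          _⊆ₛ_ (crown n) M ⟦ g ⟧ → M ≐ ⟦ g ⟧
  ⊆⟦⟧⇒≐ M maxM g indep = maximal-⊆⇒≐ (crown n) M ⟦ g ⟧ maxM (⟦⟧-independent g indep)

  maximal-classification : ∀ M → MaximalIndependent (crown n) M →
    M ≐ ⟦ sideA ⟧ ⊎ M ≐ ⟦ sideB ⟧ ⊎ ∃ λ k → M ≐ ⟦ pairP k ⟧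
  maximal-classification M maxM with independent-classification M (proj₁ maxM)
  ... | inj₁ M⊆A              = inj₁ (⊆⟦⟧⇒≐ M maxM sideA sideA-independent M⊆A)
  ... | inj₂ (inj₁ M⊆B)       = inj₂ (inj₁ (⊆⟦⟧⇒≐ M maxM sideB sideB-independent M⊆B))
  ... | inj₂ (inj₂ (k , M⊆P)) = inj₂ (inj₂ (k , ⊆⟦⟧⇒≐ M maxM (pairP k) (pairP-independent k) M⊆P))


module _ {c ℓ : Level} (F : Field c ℓ) where
  open Field F
  open import Algebra.Properties.Ring ring
    using (-1*x≈-x; x[y-z]≈xy-xz; x≈z//y; -‿distribʳ-*; +-cancelˡ; +-inverseˡ-unique;
           +-inverseʳ-unique; //-rightDividesˡ)
  open import Algebra.Properties.Semiring.Mult semiring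
    using (×-congʳ; ×-homo-+; ×-assoc-*; ×1-homo-*) renaming (_×_ to _·_)
  open import Algebra.Properties.Semiring.Sum semiring
    using (sum; sum-cong-≋; sum-replicate; sum-replicate-zero; ∑-distrib-+; *-distribˡ-sum)
  open import Relation.Binary.Reasoning.Setoid setoid

  ℕ→F≡·1 : ∀ k → ℕ→F F k ≡ k · 1#
  ℕ→F≡·1 zero    = ≡.refl
  ℕ→F≡·1 (suc k) = ≡.cong (1# +_) (ℕ→F≡·1 k)

  ℕ→F-+ : ∀ a b → ℕ→F F (a +ℕ b) ≈ ℕ→F F a + ℕ→F F b
  ℕ→F-+ a b rewrite ℕ→F≡·1 (a +ℕ b) | ℕ→F≡·1 a | ℕ→F≡·1 b = ×-homo-+ 1# a b

  ℕ→F-* : ∀ a b → ℕ→F F (a *ℕ b) ≈ ℕ→F F a * ℕ→F F b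
  ℕ→F-* a b rewrite ℕ→F≡·1 (a *ℕ b) | ℕ→F≡·1 a | ℕ→F≡·1 b = ×1-homo-* a b

  char∣⇒vanishes : ∀ {p k} → HasChar F p → p ∣ k → ℕ→F F k ≈ 0#
  char∣⇒vanishes {zero}  _ 0∣k rewrite 0∣⇒≡0 0∣k = refl
  char∣⇒vanishes {suc q} (p≈0 , _) (divides quo ≡.refl) = begin
    ℕ→F F (quo *ℕ suc q)        ≈⟨ ℕ→F-* quo (suc q) ⟩
    ℕ→F F quo * ℕ→F F (suc q)   ≈⟨ *-congˡ p≈0 ⟩
    ℕ→F F quo * 0#              ≈⟨ zeroʳ _ ⟩
    0#                          ∎

  vanishes⇒char∣ : ∀ {p k} → HasChar F p → ℕ→F F k ≈ 0# → p ∣ k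
  vanishes⇒char∣ {p}     {zero}  _ _ = p ∣0
  vanishes⇒char∣ {zero}  {suc k} never k≈0 = ⊥-elim (never k k≈0)
  vanishes⇒char∣ {suc q} {k} (p≈0 , minimal) k≈0 = m%n≡0⇒n∣m k p remainder≡0
    where
    p = suc q
    -- k = (k % p) + (k / p)·p, and p vanishes in F.
    remainder-vanishes : ℕ→F F (k % p) ≈ 0#
    remainder-vanishes = begin
      ℕ→F F (k % p)                            ≈⟨ +-identityʳ _ ⟨
      ℕ→F F (k % p) + 0#                       ≈⟨ +-congˡ (trans (*-congˡ p≈0) (zeroʳ _)) ⟨
      ℕ→F F (k % p) + ℕ→F F (k / p) * ℕ→F F p  ≈⟨ +-congˡ (ℕ→F-* (k / p) p) ⟨
      ℕ→F F (k % p) + ℕ→F F (k / p *ℕ p)       ≈⟨ ℕ→F-+ (k % p) (k / p *ℕ p) ⟨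
      ℕ→F F (k % p +ℕ k / p *ℕ p)              ≡⟨ ≡.cong (ℕ→F F) (m≡m%n+[m/n]*n k p) ⟨
      ℕ→F F k                                  ≈⟨ k≈0 ⟩
      0#                                       ∎
    -- A positive remainder below p would contradict the minimality of p.
    remainder≡0 : k % p ≡ 0
    remainder≡0 with k % p | m%n<n k p | remainder-vanishes
    ... | zero  | _       | _   = ≡.refl
    ... | suc r | s≤s r<q | r≈0 = ⊥-elim (minimal r r<q r≈0)

  nonzero-cancel : ∀ {x y} → ¬ (x ≈ 0#) → x * y ≈ 0# → y ≈ 0#
  nonzero-cancel {x} {y} x≉0 xy≈0 with inverse x x≉0
  ... | x⁻¹ , xx⁻¹≈1 = begin
    y              ≈⟨ *-identityˡ y ⟨
    1# * y         ≈⟨ *-congʳ (trans (*-comm x⁻¹ x) xx⁻¹≈1) ⟨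
    (x⁻¹ * x) * y  ≈⟨ *-assoc x⁻¹ x y ⟩
    x⁻¹ * (x * y)  ≈⟨ *-congˡ xy≈0 ⟩
    x⁻¹ * 0#       ≈⟨ zeroʳ x⁻¹ ⟩
    0#             ∎

  -- The sum ∑ F of Defs is the library's sum over the additive monoid,
  -- so its basic laws are inherited.
  ∑≡sum : ∀ {m} (f : Fin m → Carrier) → ∑ F f ≡ sum f
  ∑≡sum {zero}  f = ≡.refl
  ∑≡sum {suc m} f = ≡.cong (f Fin.zero +_) (∑≡sum (f ∘ Fin.suc))

  ∑-cong : ∀ {m} {f g : Fin m → Carrier} → (∀ i → f i ≈ g i) → ∑ F f ≈ ∑ F g
  ∑-cong {f = f} {g} f≈g rewrite ∑≡sum f | ∑≡sum g = sum-cong-≋ f≈g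

  ∑-zero : ∀ m → ∑ F {m} (λ _ → 0#) ≈ 0#
  ∑-zero m rewrite ∑≡sum {m} (λ _ → 0#) = sum-replicate-zero m

  ∑-+ : ∀ {m} (f g : Fin m → Carrier) → ∑ F (λ i → f i + g i) ≈ ∑ F f + ∑ F g
  ∑-+ f g rewrite ∑≡sum (λ i → f i + g i) | ∑≡sum f | ∑≡sum g = ∑-distrib-+ f g

  ∑-const : ∀ m x → ∑ F {m} (λ _ → x) ≈ ℕ→F F m * x
  ∑-const m x rewrite ∑≡sum {m} (λ _ → x) | ℕ→F≡·1 m = begin
    sum {m} (λ _ → x)  ≈⟨ sum-replicate m ⟩
    m · x              ≈⟨ ×-congʳ m (*-identityˡ x) ⟨
    m · (1# * x)       ≈⟨ ×-assoc-* m 1# x ⟨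
    (m · 1#) * x       ∎

  ∑-neg : ∀ {m} (f : Fin m → Carrier) → ∑ F (λ i → - f i) ≈ - ∑ F f
  ∑-neg f rewrite ∑≡sum (λ i → - f i) | ∑≡sum f = begin
    sum (λ i → - f i)       ≈⟨ sum-cong-≋ (λ i → -1*x≈-x (f i)) ⟨
    sum (λ i → - 1# * f i)  ≈⟨ *-distribˡ-sum (- 1#) f ⟨
    - 1# * sum f            ≈⟨ -1*x≈-x (sum f) ⟩
    - sum f                 ∎

  ∑-- : ∀ {m} (f g : Fin m → Carrier) → ∑ F (λ i → f i - g i) ≈ ∑ F f - ∑ F g
  ∑-- f g = trans (∑-+ f (λ i → - g i)) (+-congˡ (∑-neg g))

  ∑-split : ∀ m k (f : Fin (m +ℕ k) → Carrier) →
            ∑ F f ≈ ∑ F (λ i → f (i ↑ˡ k)) + ∑ F (λ i → f (m ↑ʳ i))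
  ∑-split zero    k f = sym (+-identityˡ _)
  ∑-split (suc m) k f = trans (+-congˡ (∑-split m k (f ∘ Fin.suc))) (sym (+-assoc _ _ _))

  δ : ∀ {m} → Fin m → Fin m → Carrier
  δ i j = if i == j then 1# else 0#

  *-if : ∀ x b → x * (if b then 1# else 0#) ≈ (if b then x else 0#)
  *-if x true  = *-identityʳ x
  *-if x false = zeroʳ x

  ∑-δ : ∀ {m} (f : Fin m → Carrier) j → ∑ F (λ i → f i * δ i j) ≈ f j
  ∑-δ {suc m} f Fin.zero = begin
    f Fin.zero * 1# + ∑ F (λ i → f (Fin.suc i) * 0#) ≈⟨ +-cong (*-identityʳ _) (∑-cong {m} (λ i → zeroʳ _)) ⟩
    f Fin.zero + ∑ F {m} (λ _ → 0#)                  ≈⟨ +-congˡ (∑-zero m) ⟩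
    f Fin.zero + 0#                                  ≈⟨ +-identityʳ _ ⟩
    f Fin.zero                                       ∎
  ∑-δ f (Fin.suc j) = trans (+-cong (zeroʳ _) (∑-δ (f ∘ Fin.suc) j)) (+-identityˡ _)

  ∑-δ-row : ∀ {m} (k : Fin m) → ∑ F (δ k) ≈ 1#
  ∑-δ-row k = trans (∑-cong row≈column) (∑-δ (λ _ → 1#) k)
    where
    row≈column : ∀ j → δ k j ≈ 1# * δ j k
    row≈column j = trans (reflexive (≡.cong (λ b → if b then 1# else 0#) (==-sym k j)))
                         (sym (*-identityˡ _))

  ∑-select : ∀ {m} (f : Fin m → Carrier) k → ∑ F (λ i → if i == k then f i else 0#) ≈ f k
  ∑-select f k = trans (∑-cong (λ i → sym (*-if (f i) (i == k)))) (∑-δ f k)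

  ≐⇒weight≈ : ∀ {m} (w : Fin m → Carrier) S T → S ≐ T → weight F w S ≈ weight F w T
  ≐⇒weight≈ w _ _ S≐T = ∑-cong (λ x → reflexive (≡.cong (λ b → if b then w x else 0#) (S≐T x)))

  -- A weighting u of the crown graph's vertices (aᵢ = inj₁ i, bᵢ = inj₂ i)
  -- is balanced with value s if all maximal independent sets A, B and
  -- Pᵢ = {aᵢ, bᵢ} have weight s.
  record Balanced {n : ℕ} (s : Carrier) (u : Side n → Carrier) : Set ℓ where
    field
      pair-sum  : ∀ i → u (inj₁ i) + u (inj₂ i) ≈ s
      sideA-sum : ∑ F (u ∘ inj₁) ≈ s
      sideB-sum : ∑ F (u ∘ inj₂) ≈ s

  Balanced-cong : ∀ {n s} {u v : Side n → Carrier} → (∀ x → u x ≈ v x) → Balanced s u → Balanced s v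
  Balanced-cong u≈v bal = record
    { pair-sum  = λ i → trans (sym (+-cong (u≈v (inj₁ i)) (u≈v (inj₂ i)))) (pair-sum i)
    ; sideA-sum = trans (sym (∑-cong (u≈v ∘ inj₁))) sideA-sum
    ; sideB-sum = trans (sym (∑-cong (u≈v ∘ inj₂))) sideB-sum
    }
    where open Balanced bal

  -- Adding up the n = r + 2 pair conditions: ΣA + ΣB ≈ n·s = s + (s + r·s).
  pair-sums-total : ∀ {r s} (u : Side (2 +ℕ r) → Carrier) →
    (∀ i → u (inj₁ i) + u (inj₂ i) ≈ s) → ∑ F (u ∘ inj₁) + ∑ F (u ∘ inj₂) ≈ s + (s + ℕ→F F r * s)
  pair-sums-total {r} {s} u pairs = begin
    ∑ F (u ∘ inj₁) + ∑ F (u ∘ inj₂)      ≈⟨ ∑-+ (u ∘ inj₁) (u ∘ inj₂) ⟨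
    ∑ F (λ i → u (inj₁ i) + u (inj₂ i))  ≈⟨ ∑-cong pairs ⟩
    ∑ F {2 +ℕ r} (λ _ → s)               ≈⟨ +-congˡ (+-congˡ (∑-const r s)) ⟩
    s + (s + ℕ→F F r * s)                ∎

  balanced-defect : ∀ {r s} {u : Side (2 +ℕ r) → Carrier} → Balanced s u → ℕ→F F r * s ≈ 0#
  balanced-defect {r} {s} {u} bal = +-cancelˡ s _ _ (+-cancelˡ s _ _ (begin
    s + (s + ℕ→F F r * s)            ≈⟨ pair-sums-total u pair-sum ⟨
    ∑ F (u ∘ inj₁) + ∑ F (u ∘ inj₂)  ≈⟨ +-cong sideA-sum sideB-sum ⟩
    s + s                            ≈⟨ +-congˡ (+-identityʳ s) ⟨
    s + (s + 0#)                     ∎))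
    where open Balanced bal

  balanced-from-pairs : ∀ {r s} (u : Side (2 +ℕ r) → Carrier) →
    (∀ i → u (inj₁ i) + u (inj₂ i) ≈ s) → ∑ F (u ∘ inj₁) ≈ s → ℕ→F F r * s ≈ 0# → Balanced s u
  balanced-from-pairs {r} {s} u pairs sumA defect = record
    { pair-sum = pairs ; sideA-sum = sumA ; sideB-sum = +-cancelˡ s _ _ (begin
      s + ∑ F (u ∘ inj₂)               ≈⟨ +-congʳ sumA ⟨
      ∑ F (u ∘ inj₁) + ∑ F (u ∘ inj₂)  ≈⟨ pair-sums-total u pairs ⟩
      s + (s + ℕ→F F r * s)            ≈⟨ +-congˡ (trans (+-congˡ defect) (+-identityʳ s)) ⟩
      s + s                            ∎) }

  coordinate-basis : ∀ {m d} (G : Graph m) (B : Fin d → Fin m → Carrier) (pos : Fin d → Fin m) →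
    (∀ k → WellCovered F G (B k)) → (∀ k i → B k (pos i) ≈ δ k i) →
    (∀ w → WellCovered F G w → ∀ x → w x ≈ lincomb F (w ∘ pos) B x) → WcDim F G d
  coordinate-basis G B pos wcB unit expand = B , wcB , independent , λ w wc → w ∘ pos , expand w wc
    where
    independent : ∀ coef → (∀ x → lincomb F coef B x ≈ 0#) → ∀ i → coef i ≈ 0#
    independent coef vanishes i = begin
      coef i                      ≈⟨ ∑-δ coef i ⟨
      ∑ F (λ k → coef k * δ k i)  ≈⟨ ∑-cong (λ k → *-congˡ (unit k i)) ⟨
      lincomb F coef B (pos i)    ≈⟨ vanishes (pos i) ⟩
      0#                          ∎

  module CrownWeights (n : ℕ) where
    open CrownSets n

    weight-⟦⟧ : ∀ w g → weight F w ⟦ g ⟧ ≈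
      ∑ F (λ i → if g (inj₁ i) then w (vertex (inj₁ i)) else 0#) +
      ∑ F (λ i → if g (inj₂ i) then w (vertex (inj₂ i)) else 0#)
    weight-⟦⟧ w g = trans (∑-split n n _) (+-cong (∑-cong (member ∘ inj₁)) (∑-cong (member ∘ inj₂)))
      where
      member : ∀ u → (if lookup ⟦ g ⟧ (vertex u) then w (vertex u) else 0#) ≈
                     (if g u then w (vertex u) else 0#)
      member u = reflexive (≡.cong (λ b → if b then w (vertex u) else 0#) (lookup-⟦⟧-vertex g u))

    weight-sideA : ∀ w → weight F w ⟦ sideA ⟧ ≈ ∑ F (w ∘ vertex ∘ inj₁)
    weight-sideA w = trans (weight-⟦⟧ w sideA) (trans (+-congˡ (∑-zero n)) (+-identityʳ _))

    weight-sideB : ∀ w → weight F w ⟦ sideB ⟧ ≈ ∑ F (w ∘ vertex ∘ inj₂)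
    weight-sideB w = trans (weight-⟦⟧ w sideB) (trans (+-congʳ (∑-zero n)) (+-identityˡ _))

    weight-pairP : ∀ w k → weight F w ⟦ pairP k ⟧ ≈ w (vertex (inj₁ k)) + w (vertex (inj₂ k))
    weight-pairP w k = trans (weight-⟦⟧ w (pairP k))
                             (+-cong (∑-select (w ∘ vertex ∘ inj₁) k) (∑-select (w ∘ vertex ∘ inj₂) k))

    wellCovered⇒balanced : 2 ≤ n → ∀ w → WellCovered F (crown n) w →
                           Balanced (∑ F (w ∘ vertex ∘ inj₁)) (w ∘ vertex)
    wellCovered⇒balanced 2≤n w wc = record
      { pair-sum  = λ i → weighs-as-A ⟦ pairP i ⟧ (weight-pairP w i) (pairP-maximal i)
      ; sideA-sum = refl
      ; sideB-sum = weighs-as-A ⟦ sideB ⟧ (weight-sideB w) (sideB-maximal 2≤n)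
      }
      where
      weighs-as-A : ∀ M {x} → weight F w M ≈ x → MaximalIndependent (crown n) M →
                    x ≈ ∑ F (w ∘ vertex ∘ inj₁)
      weighs-as-A M M≈x maxM =
        trans (sym M≈x) (trans (wc M ⟦ sideA ⟧ maxM (sideA-maximal 2≤n)) (weight-sideA w))

    balanced⇒wellCovered : ∀ {s} w → Balanced s (w ∘ vertex) → WellCovered F (crown n) w
    balanced⇒wellCovered {s} w bal M M′ maxM maxM′ =
      trans (weighs-s M maxM) (sym (weighs-s M′ maxM′))
      where
      open Balanced bal
      weighs-s : ∀ M → MaximalIndependent (crown n) M → weight F w M ≈ s
      weighs-s M maxM with maximal-classification M maxM
      ... | inj₁ M≐A =
        trans (≐⇒weight≈ w M ⟦ sideA ⟧ M≐A) (trans (weight-sideA w) sideA-sum)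
      ... | inj₂ (inj₁ M≐B) =
        trans (≐⇒weight≈ w M ⟦ sideB ⟧ M≐B) (trans (weight-sideB w) sideB-sum)
      ... | inj₂ (inj₂ (k , M≐P)) =
        trans (≐⇒weight≈ w M ⟦ pairP k ⟧ M≐P) (trans (weight-pairP w k) (pair-sum k))

    crown-basis : ∀ {d} → 2 ≤ n → (U : Fin d → Side n → Carrier) (pos : Fin d → Side n) →
      (∀ k → ∃ λ s → Balanced s (U k)) → (∀ k i → U k (pos i) ≈ δ k i) →
      (∀ {s} u → Balanced s u → ∀ v → u v ≈ ∑ F (λ k → u (pos k) * U k v)) →
      WcDim F (crown n) d
    crown-basis {d} 2≤n U pos balU unit expand =
      coordinate-basis (crown n) B (vertex ∘ pos) wcB
        (λ k i → trans (B-vertex k (pos i)) (unit k i)) expandB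
      where
      B : Fin d → Fin (n +ℕ n) → Carrier
      B k = U k ∘ splitAt n
      B-vertex : ∀ k v → B k (vertex v) ≈ U k v
      B-vertex k v = reflexive (≡.cong (U k) (splitAt-join n n v))
      wcB : ∀ k → WellCovered F (crown n) (B k)
      wcB k = balanced⇒wellCovered (B k) (Balanced-cong (λ v → sym (B-vertex k v)) (proj₂ (balU k)))
      expandB : ∀ w → WellCovered F (crown n) w → ∀ x → w x ≈ lincomb F (w ∘ vertex ∘ pos) B x
      expandB w wc x = begin
        w x                               ≡⟨ ≡.cong w (join-splitAt n n x) ⟨
        w (vertex (splitAt n x))          ≈⟨ expand (w ∘ vertex) (wellCovered⇒balanced 2≤n w wc)
                                                    (splitAt n x) ⟩
        lincomb F (w ∘ vertex ∘ pos) B x  ∎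

  2≤2+r : ∀ r → 2 ≤ 2 +ℕ r
  2≤2+r _ = s≤s (s≤s z≤n)

  -- Case n - 2 = 0 in F: the weightings are free on A, with bⱼ = s - aⱼ and
  -- s = ΣA.  Basis Uₖ : aⱼ ↦ δₖⱼ, bⱼ ↦ 1 - δₖⱼ (of value 1), coordinates aₖ.
  wcdim-when-vanishing : ∀ r → ℕ→F F r ≈ 0# → WcDim F (crown (2 +ℕ r)) (2 +ℕ r)
  wcdim-when-vanishing r r≈0 = crown-basis (2≤2+r r) U inj₁ balanced (λ _ _ → refl) expand
    where
    open CrownWeights (2 +ℕ r)
    U : Fin (2 +ℕ r) → Side (2 +ℕ r) → Carrier
    U k (inj₁ j) = δ k j
    U k (inj₂ j) = 1# - δ k j
    balanced : ∀ k → ∃ λ s → Balanced s (U k)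
    balanced k = 1# , balanced-from-pairs (U k)
      (λ j → trans (+-comm _ _) (//-rightDividesˡ (δ k j) 1#)) (∑-δ-row k)
      (trans (*-congʳ r≈0) (zeroˡ 1#))
    expand : ∀ {s} u → Balanced s u → ∀ v → u v ≈ ∑ F (λ k → u (inj₁ k) * U k v)
    expand u bal (inj₁ j) = sym (∑-δ (u ∘ inj₁) j)
    expand {s} u bal (inj₂ j) = begin
      u (inj₂ j)                                       ≈⟨ x≈z//y _ _ _ (trans (+-comm _ _) (pair-sum j)) ⟩
      s - u (inj₁ j)                                   ≈⟨ +-cong sideA-sum (-‿cong (∑-δ (u ∘ inj₁) j)) ⟨
      ∑ F (u ∘ inj₁) - ∑ F (λ k → u (inj₁ k) * δ k j)  ≈⟨ ∑-- (u ∘ inj₁) (λ k → u (inj₁ k) * δ k j) ⟨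
      ∑ F (λ k → u (inj₁ k) - u (inj₁ k) * δ k j)      ≈⟨ ∑-cong distribute ⟨
      ∑ F (λ k → u (inj₁ k) * (1# - δ k j))            ∎
      where
      open Balanced bal
      distribute : ∀ k → u (inj₁ k) * (1# - δ k j) ≈ u (inj₁ k) - u (inj₁ k) * δ k j
      distribute k = trans (x[y-z]≈xy-xz _ 1# (δ k j)) (+-congʳ (*-identityʳ _))

  -- Case n - 2 ≠ 0 in F: then s = 0, so bⱼ = -aⱼ and ΣA = 0.  Basis
  -- Uₖ : a₀ ↦ -1, aⱼ₊₁ ↦ δₖⱼ, bⱼ ↦ -Uₖ(aⱼ) (of value 0), coordinates aₖ₊₁.
  wcdim-when-nonvanishing : ∀ r → ¬ (ℕ→F F r ≈ 0#) → WcDim F (crown (2 +ℕ r)) (1 +ℕ r)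
  wcdim-when-nonvanishing r r≉0 = crown-basis (2≤2+r r) U pos balanced (λ _ _ → refl) expand
    where
    open CrownWeights (2 +ℕ r)
    Uᴬ : Fin (1 +ℕ r) → Fin (2 +ℕ r) → Carrier
    Uᴬ k Fin.zero    = - 1#
    Uᴬ k (Fin.suc j) = δ k j
    U : Fin (1 +ℕ r) → Side (2 +ℕ r) → Carrier
    U k (inj₁ j) = Uᴬ k j
    U k (inj₂ j) = - Uᴬ k j
    pos : Fin (1 +ℕ r) → Side (2 +ℕ r)
    pos k = inj₁ (Fin.suc k)
    balanced : ∀ k → ∃ λ s → Balanced s (U k)
    balanced k = 0# , balanced-from-pairs (U k) (λ j → -‿inverseʳ _)
      (trans (+-congˡ (∑-δ-row k)) (-‿inverseˡ 1#)) (zeroʳ _)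
    expand : ∀ {s} u → Balanced s u → ∀ v → u v ≈ ∑ F (λ k → u (pos k) * U k v)
    expand {s} u bal = expand-side
      where
      open Balanced bal
      coord : Fin (1 +ℕ r) → Carrier
      coord k = u (pos k)
      s≈0 : s ≈ 0#
      s≈0 = nonzero-cancel r≉0 (balanced-defect bal)
      expand-A : ∀ j → u (inj₁ j) ≈ ∑ F (λ k → coord k * U k (inj₁ j))
      expand-A Fin.zero = begin
        u (inj₁ Fin.zero)             ≈⟨ +-inverseˡ-unique _ _ (trans sideA-sum s≈0) ⟩
        - ∑ F coord                   ≈⟨ ∑-neg coord ⟨
        ∑ F (λ k → - coord k)         ≈⟨ ∑-cong {1 +ℕ r} (λ k → -‿cong (*-identityʳ (coord k))) ⟨
        ∑ F (λ k → - (coord k * 1#))  ≈⟨ ∑-cong {1 +ℕ r} (λ k → -‿distribʳ-* (coord k) 1#) ⟩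
        ∑ F (λ k → coord k * - 1#)    ∎
      expand-A (Fin.suc j) = sym (∑-δ coord j)
      expand-side : ∀ v → u v ≈ ∑ F (λ k → coord k * U k v)
      expand-side (inj₁ j) = expand-A j
      expand-side (inj₂ j) = begin
        u (inj₂ j)                              ≈⟨ +-inverseʳ-unique _ _ (trans (pair-sum j) s≈0) ⟩
        - u (inj₁ j)                            ≈⟨ -‿cong (expand-A j) ⟩
        - ∑ F (λ k → coord k * Uᴬ k j)          ≈⟨ ∑-neg (λ k → coord k * Uᴬ k j) ⟨
        ∑ F (λ k → - (coord k * Uᴬ k j))        ≈⟨ ∑-cong {1 +ℕ r} (λ k → -‿distribʳ-* (coord k) (Uᴬ k j)) ⟩
        ∑ F (λ k → coord k * - Uᴬ k j)          ∎

∣suc⇒≢0 : ∀ {p t} → p ∣ suc t → p ≢ 0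
∣suc⇒≢0 p∣ ≡.refl with () ← 0∣⇒≡0 p∣

mainTheorem1 : ∀ {c ℓ} (F : Field c ℓ) (n : ℕ) → 2 < n → (p : ℕ) → HasChar F p →
    ((p ≢ 0 × p ∣ (n ∸ 2)) → WcDim F (crown n) n)
    × (¬ (p ≢ 0 × p ∣ (n ∸ 2)) → WcDim F (crown n) (n ∸ 1))
mainTheorem1 F (suc (suc (suc t))) _ p char = char-divides , char-does-not-divide
  where
  -- here n - 2 = suc t
  char-divides : p ≢ 0 × p ∣ suc t → WcDim F (crown (3 +ℕ t)) (3 +ℕ t)
  char-divides (_ , p∣n-2) = wcdim-when-vanishing F (suc t) (char∣⇒vanishes F char p∣n-2)
  char-does-not-divide : ¬ (p ≢ 0 × p ∣ suc t) → WcDim F (crown (3 +ℕ t)) (2 +ℕ t)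
  char-does-not-divide p∤n-2 = wcdim-when-nonvanishing F (suc t) λ n-2≈0 →
    let p∣n-2 = vanishes⇒char∣ F char n-2≈0 in p∤n-2 (∣suc⇒≢0 p∣n-2 , p∣n-2)
mainTheorem1 F zero             ()
mainTheorem1 F (suc zero)       (s≤s ())
mainTheorem1 F (suc (suc zero)) (s≤s (s≤s ()))
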